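{- Let $\mathbb{F}$ be a field and let $h_1(z_1),\ldots,h_n(z_n)$ be univariate polynomials over $\mathbb{F}$, each of degree at most $D$. Then there exist polynomials $B_1(\mathbf{z}),\ldots,B_n(\mathbf{z})\in\mathbb{F}[z_1,\ldots,z_n]$ such that $$h_1(z_1)\cdots h_n(z_n)=\mathsf{ml}\Big[\prod_{i=1}^nh_i(z_i)\Big]+\sum_{j=1}^nB_j(\mathbf{z})\cdot(z_j^2-z_j),$$ where each $B_j$ has a circuit of size $O(nD^2)$ and depth $3$ (a $\Pi\Sigma\Pi$ circuit).
   Context: For a polynomial $g$, its multilinearization $\mathsf{ml}[g]$ is obtained by replacing, for every variable $z_j$ and every $e\ge1$, each occurrence of $z_j^e$ by $z_j$. -}

module Defs where

open import Level using (Level; _⊔_) renaming (suc to lsuc)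
open import Algebra.Bundles using (CommutativeRing)
open import Data.Nat as ℕ using (ℕ; zero; suc)
open import Data.Fin using (Fin; _≟_)
open import Data.Vec using (Vec; []; _∷_; lookup; replicate; zipWith; map; updateAt; tabulate)
import Data.Vec.Properties as VecP
open import Data.List as List using (List; []; _∷_; _++_; concatMap; allFin; foldr; length)
open import Data.Product using (_×_; _,_; ∃)
open import Relation.Nullary using (¬_; yes; no)

record Field (a ℓ : Level) : Set (lsuc (a ⊔ ℓ)) where
  field
    commutativeRing : CommutativeRing a ℓ
  open CommutativeRing commutativeRing public
  field
    0≉1     : ¬ (0# ≈ 1#)
    inverse : ∀ x → ¬ (x ≈ 0#) → ∃ λ y → (x * y) ≈ 1#

module Poly {a ℓ : Level} (F : Field a ℓ) (n : ℕ) where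
  open Field F

  Exp : Set
  Exp = Vec ℕ n

  -- a polynomial is a finite formal sum of terms c · z^e (repetitions allowed)
  Polynomial : Set a
  Polynomial = List (Carrier × Exp)

  coeff : Polynomial → Exp → Carrier
  coeff p e = foldr step 0# p
    where
    step : Carrier × Exp → Carrier → Carrier
    step (c , e′) acc with VecP.≡-dec ℕ._≟_ e e′
    ... | yes _ = c + acc
    ... | no  _ = acc

  infix 4 _≈ₚ_
  _≈ₚ_ : Polynomial → Polynomial → Set ℓ
  p ≈ₚ q = ∀ e → coeff p e ≈ coeff q e

  zeroP : Polynomial
  zeroP = []

  oneP : Polynomial
  oneP = (1# , replicate n 0) ∷ []

  infixl 6 _+ₚ_
  infixl 7 _*ₚ_
  _+ₚ_ : Polynomial → Polynomial → Polynomial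
  p +ₚ q = p ++ q

  _*ₚ_ : Polynomial → Polynomial → Polynomial
  p *ₚ q = concatMap (λ { (c , e) → List.map (λ { (d , f) → (c * d , zipWith ℕ._+_ e f) }) q }) p

  sumP : List Polynomial → Polynomial
  sumP = foldr _+ₚ_ zeroP

  prodP : List Polynomial → Polynomial
  prodP = foldr _*ₚ_ oneP

  unitExp : Fin n → ℕ → Exp
  unitExp j k = updateAt (replicate n 0) j (λ _ → k)

  varP : Fin n → Polynomial
  varP j = (1# , unitExp j 1) ∷ []

  -- h(z_j) for a univariate h of degree ≤ D given by coefficients h₀,…,h_D
  univariateAt : ∀ {D} → Vec Carrier (suc D) → Fin n → Polynomial
  univariateAt {D} h j = List.map (λ k → (lookup h k , unitExp j (Data.Fin.toℕ k))) (allFin (suc D))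

  ml : Polynomial → Polynomial
  ml = List.map (λ { (c , e) → (c , map (ℕ._⊓ 1) e) })

  booleanAxiom : Fin n → Polynomial
  booleanAxiom j = (1# , unitExp j 2) ∷ (- 1# , unitExp j 1) ∷ []

  -- Depth-3 ΠΣΠ circuits over F with inputs z₁,…,zₙ:
  -- a top product gate of sum gates; each sum gate is a linear
  -- combination (field constants on its input wires) of bottom product
  -- gates; each bottom product gate multiplies input variables
  -- (one wire per listed variable; the empty product is 1).
  ProdGate : Set
  ProdGate = List (Fin n)

  SumGate : Set a
  SumGate = List (Carrier × ProdGate)

  ΠΣΠ : Set a
  ΠΣΠ = List SumGate

  evalProd : ProdGate → Polynomial
  evalProd g = prodP (List.map varP g)

  evalSum : SumGate → Polynomial
  evalSum s = sumP (List.map (λ { (c , g) → ((c , replicate n 0) ∷ []) *ₚ evalProd g }) s)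

  eval : ΠΣΠ → Polynomial
  eval C = prodP (List.map evalSum C)

  -- size = number of gates + number of wires
  sizeProd : ProdGate → ℕ
  sizeProd g = 1 ℕ.+ length g

  sizeSum : SumGate → ℕ
  sizeSum s = 1 ℕ.+ foldr (λ { (_ , g) acc → 1 ℕ.+ sizeProd g ℕ.+ acc }) 0 s

  size : ΠΣΠ → ℕ
  size C = 1 ℕ.+ foldr (λ s acc → 1 ℕ.+ sizeSum s ℕ.+ acc) 0 C

-- Write tᵢ = zᵢ² − zᵢ. Since zᵢ² = zᵢ + tᵢ, dividing hᵢ(zᵢ) by tᵢ leaves the remainder
-- Aᵢ = hᵢ,₀ + (hᵢ,₁ + ⋯ + hᵢ,D) zᵢ = ml[hᵢ(zᵢ)], so Hᵢ := hᵢ(zᵢ) = Aᵢ + Qᵢ tᵢ with deg Qᵢ < D.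
-- Expanding H₁ ⋯ Hₙ one factor at a time gives
--   H₁ ⋯ Hₙ = A₁ ⋯ Aₙ + Σⱼ (A₁ ⋯ Aⱼ₋₁ · Qⱼ · Hⱼ₊₁ ⋯ Hₙ) tⱼ,
-- and A₁ ⋯ Aₙ = ml[H₁ ⋯ Hₙ] because multilinearization is multiplicative on polynomials in
-- distinct variables. Each Bⱼ is a ΠΣΠ circuit: a product of n sum gates, each combining at most
-- D + 1 powers of a single variable, hence of size O(D²).
module Submission where

open import Defs
open import Level using (Level; _⊔_)
open import Algebra.Bundles using (CommutativeSemiring)
import Algebra.Solver.Ring.NaturalCoefficients.Default as NaturalCoefficientSolver
import Relation.Binary.Reasoning.Setoid
open import Data.Nat as ℕ using (ℕ; zero; suc; _⊓_; _≤_; z≤n; s≤s)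
import Data.Nat.Properties as ℕP
open import Data.Nat.Solver using (module +-*-Solver)
open import Data.Fin as Fin using (Fin)
open import Data.Fin.Properties as FinP using (<-cmp)
open import Data.Vec as V using (Vec; []; _∷_)
import Data.Vec.Properties as VecP
open import Data.List as L using (List; []; _∷_; _++_)
open import Data.List.Membership.Propositional using (_∉_)
open import Data.List.Relation.Unary.All as All using (All; []; _∷_)
import Data.List.Relation.Unary.All.Properties as AllP
open import Data.List.Relation.Unary.Unique.Propositional using (Unique)
open import Data.List.Relation.Unary.Unique.Propositional.Properties using (allFin⁺)
import Data.List.Relation.Unary.AllPairs.Properties as AllPairsP
open import Data.List.Relation.Unary.Any using (here; there)
open import Data.List.Relation.Unary.AllPairs using (AllPairs; []; _∷_)
open import Data.Product using (Σ; _×_; _,_; proj₁; proj₂)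
open import Data.Product.Relation.Binary.Pointwise.NonDependent using () renaming (Pointwise to ×-Pointwise)
open import Data.List.Relation.Binary.Pointwise as Pw using (Pointwise; []; _∷_)
import Data.List.Properties as LP
open import Relation.Binary.Definitions using (tri<; tri≈; tri>)
open import Relation.Binary.PropositionalEquality as ≡ using (_≡_; _≢_)
open import Relation.Nullary using (yes; no; contradiction)
open import Relation.Binary.Structures using (IsEquivalence)
open import Function using (_∘_)

private
  variable
    x : Level
    m : ℕ

-- Exponent vectors

infixl 6 _+ᵥ_ _∸ᵥ_

_+ᵥ_ _∸ᵥ_ : Vec ℕ m → Vec ℕ m → Vec ℕ m
_+ᵥ_ = V.zipWith ℕ._+_
_∸ᵥ_ = V.zipWith ℕ._∸_

0ᵥ : Vec ℕ m
0ᵥ = V.replicate _ 0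

+ᵥ-comm : (u v : Vec ℕ m) → u +ᵥ v ≡ v +ᵥ u
+ᵥ-comm = VecP.zipWith-comm ℕP.+-comm

+ᵥ-assoc : (u v w : Vec ℕ m) → u +ᵥ v +ᵥ w ≡ u +ᵥ (v +ᵥ w)
+ᵥ-assoc = VecP.zipWith-assoc ℕP.+-assoc

+ᵥ-identityˡ : (u : Vec ℕ m) → 0ᵥ +ᵥ u ≡ u
+ᵥ-identityˡ = VecP.zipWith-identityˡ ℕP.+-identityˡ

+ᵥ-identityʳ : (u : Vec ℕ m) → u +ᵥ 0ᵥ ≡ u
+ᵥ-identityʳ = VecP.zipWith-identityʳ ℕP.+-identityʳ

+ᵥ-∸ᵥ-cancelˡ : (u v : Vec ℕ m) → u +ᵥ v ∸ᵥ u ≡ v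
+ᵥ-∸ᵥ-cancelˡ []      []      = ≡.refl
+ᵥ-∸ᵥ-cancelˡ (a ∷ u) (b ∷ v) = ≡.cong₂ _∷_ (ℕP.m+n∸m≡n a b) (+ᵥ-∸ᵥ-cancelˡ u v)

-- Poly.unitExp, without the dependence on the field.
unitVec : Fin m → ℕ → Vec ℕ m
unitVec {m} i k = V.updateAt (V.replicate m 0) i (λ _ → k)

unitVec-+ : (i : Fin m) (a b : ℕ) → unitVec i a +ᵥ unitVec i b ≡ unitVec i (a ℕ.+ b)
unitVec-+ {suc m} Fin.zero    a b = ≡.cong (a ℕ.+ b ∷_) (+ᵥ-identityˡ 0ᵥ)
unitVec-+ {suc m} (Fin.suc i) a b = ≡.cong (0 ∷_) (unitVec-+ i a b)

unitVec-zero : (i : Fin m) → unitVec i 0 ≡ 0ᵥ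
unitVec-zero {suc m} Fin.zero    = ≡.refl
unitVec-zero {suc m} (Fin.suc i) = ≡.cong (0 ∷_) (unitVec-zero i)

lookup-unitVec-≢ : {i k : Fin m} (b : ℕ) → k ≢ i → V.lookup (unitVec i b) k ≡ 0
lookup-unitVec-≢ {m} {i} {k} b k≢i =
  ≡.trans (VecP.lookup∘updateAt′ k i k≢i (V.replicate m 0)) (VecP.lookup-replicate k 0)

mlExp : Vec ℕ m → Vec ℕ m
mlExp = V.map (_⊓ 1)

+-⊓1 : ∀ a b → (a ℕ.+ b) ⊓ 1 ≡ (a ⊓ 1 ℕ.+ b ⊓ 1) ⊓ 1
+-⊓1 zero    zero    = ≡.refl
+-⊓1 zero    (suc b) = ≡.cong suc (≡.trans (ℕP.⊓-zeroʳ b) (≡.sym (ℕP.⊓-zeroʳ (b ⊓ 0))))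
+-⊓1 (suc a) b       = ≡.cong suc (≡.trans (ℕP.⊓-zeroʳ (a ℕ.+ b)) (≡.sym (ℕP.⊓-zeroʳ _)))

mlExp-+ᵥ : (u v : Vec ℕ m) → mlExp (u +ᵥ v) ≡ mlExp (mlExp u +ᵥ mlExp v)
mlExp-+ᵥ []      []      = ≡.refl
mlExp-+ᵥ (a ∷ u) (b ∷ v) = ≡.cong₂ _∷_ (+-⊓1 a b) (mlExp-+ᵥ u v)

mlExp-idem : (u : Vec ℕ m) → mlExp (mlExp u) ≡ mlExp u
mlExp-idem u = ≡.trans (≡.sym (VecP.map-∘ (_⊓ 1) (_⊓ 1) u)) (VecP.map-cong (λ a → ℕP.⊓-assoc a 1 1) u)

mlExp-unitVec : (i : Fin m) (k : ℕ) → mlExp (unitVec i k) ≡ unitVec i (k ⊓ 1)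
mlExp-unitVec {suc m} Fin.zero    k = ≡.cong (k ⊓ 1 ∷_) (VecP.map-replicate (_⊓ 1) 0 m)
mlExp-unitVec {suc m} (Fin.suc i) k = ≡.cong (0 ∷_) (mlExp-unitVec i k)

MultilinearIn : List (Fin m) → Vec ℕ m → Set
MultilinearIn vs e = ∀ k → V.lookup e k ≤ 1 × (k ∉ vs → V.lookup e k ≡ 0)

0ᵥ-multilinearIn : MultilinearIn {m} [] 0ᵥ
0ᵥ-multilinearIn k = ℕP.≤-trans (ℕP.≤-reflexive (VecP.lookup-replicate k 0)) z≤n
                   , λ _ → VecP.lookup-replicate k 0

unitVec-multilinearIn : (i : Fin m) {b : ℕ} → b ≤ 1 → MultilinearIn (i ∷ []) (unitVec i b)
unitVec-multilinearIn {m} i {b} b≤1 k with k Fin.≟ i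
... | yes ≡.refl = ≡.subst (_≤ 1) (≡.sym (VecP.lookup∘updateAt i (V.replicate m 0))) b≤1
                 , λ i∉ → contradiction (here ≡.refl) i∉
... | no  k≢i    = ℕP.≤-trans (ℕP.≤-reflexive (lookup-unitVec-≢ b k≢i)) z≤n
                 , λ _ → lookup-unitVec-≢ b k≢i

+ᵥ-multilinearIn : {i : Fin m} {vs : List (Fin m)} (e f : Vec ℕ m) → i ∉ vs →
  MultilinearIn (i ∷ []) e → MultilinearIn vs f → MultilinearIn (i ∷ vs) (e +ᵥ f)
+ᵥ-multilinearIn {i = i} {vs} e f i∉vs me mf k
  rewrite VecP.lookup-zipWith ℕ._+_ k e f with k Fin.≟ i
... | yes ≡.refl rewrite proj₂ (mf k) i∉vs | ℕP.+-identityʳ (V.lookup e k) =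
      proj₁ (me k) , λ k∉ → contradiction (here ≡.refl) k∉
... | no  k≢i rewrite proj₂ (me k) (λ { (here k≡i) → k≢i k≡i ; (there ()) }) =
      proj₁ (mf k) , λ k∉ → proj₂ (mf k) (λ k∈ → k∉ (there k∈))

mlExp-id : {e : Vec ℕ m} → (∀ k → V.lookup e k ≤ 1) → mlExp e ≡ e
mlExp-id {e = []}    e≤1 = ≡.refl
mlExp-id {e = a ∷ e} e≤1 = ≡.cong₂ _∷_ (ℕP.m≤n⇒m⊓n≡m (e≤1 Fin.zero)) (mlExp-id (e≤1 ∘ Fin.suc))

byOrder : {X : Set x} → Fin m → Fin m → X → X → X → X
byOrder i j lt eq gt with <-cmp i j
... | tri< _ _ _ = lt
... | tri≈ _ _ _ = eq
... | tri> _ _ _ = gt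

module _ {X : Set x} {a b c : X} where

  byOrder-< : {i j : Fin m} → i Fin.< j → byOrder i j a b c ≡ a
  byOrder-< {i = i} {j} i<j with <-cmp i j
  ... | tri< _ _ _  = ≡.refl
  ... | tri≈ i≮j _ _ = contradiction i<j i≮j
  ... | tri> i≮j _ _ = contradiction i<j i≮j

  byOrder-≡ : (i : Fin m) → byOrder i i a b c ≡ b
  byOrder-≡ i with <-cmp i i
  ... | tri< _ i≢i _ = contradiction ≡.refl i≢i
  ... | tri≈ _ _ _   = ≡.refl
  ... | tri> _ i≢i _ = contradiction ≡.refl i≢i

  byOrder-> : {i j : Fin m} → j Fin.< i → byOrder i j a b c ≡ c
  byOrder-> {i = i} {j} j<i with <-cmp i j
  ... | tri< _ _ j≮i = contradiction j<i j≮i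
  ... | tri≈ _ _ j≮i = contradiction j<i j≮i
  ... | tri> _ _ _   = ≡.refl

  byOrder-map : ∀ {y} {Y : Set y} (f : X → Y) (i j : Fin m) → f (byOrder i j a b c) ≡ byOrder i j (f a) (f b) (f c)
  byOrder-map f i j with <-cmp i j
  ... | tri< _ _ _ = ≡.refl
  ... | tri≈ _ _ _ = ≡.refl
  ... | tri> _ _ _ = ≡.refl

  byOrder-preserves : ∀ {p} (P : X → Set p) → P a → P b → P c → (i j : Fin m) → P (byOrder i j a b c)
  byOrder-preserves P pa pb pc i j with <-cmp i j
  ... | tri< _ _ _ = pa
  ... | tri≈ _ _ _ = pb
  ... | tri> _ _ _ = pc

-- Sums, products and division by z² − z in a commutative semiring

module CommutativeSemiringLemmas {c ℓ} (R : CommutativeSemiring c ℓ) where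
  open CommutativeSemiring R
  open import Relation.Binary.Reasoning.Setoid setoid
  open NaturalCoefficientSolver R using (solve; _:+_; _:*_; _:=_; con)
  open import Algebra.Properties.CommutativeSemigroup +-commutativeSemigroup using (interchange)

  ∑ ∏ : List Carrier → Carrier
  ∑ = L.foldr _+_ 0#
  ∏ = L.foldr _*_ 1#

  module _ {A : Set x} where

    ∑-cong : {f g : A → Carrier} {as : List A} → All (λ a → f a ≈ g a) as → ∑ (L.map f as) ≈ ∑ (L.map g as)
    ∑-cong []           = refl
    ∑-cong (fa≈ga ∷ eq) = +-cong fa≈ga (∑-cong eq)

    ∏-cong : {f g : A → Carrier} {as : List A} → All (λ a → f a ≈ g a) as → ∏ (L.map f as) ≈ ∏ (L.map g as)
    ∏-cong []           = refl
    ∏-cong (fa≈ga ∷ eq) = *-cong fa≈ga (∏-cong eq)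

    *-distribˡ-∑ : (r : Carrier) (f : A → Carrier) (as : List A) →
                   ∑ (L.map (λ a → r * f a) as) ≈ r * ∑ (L.map f as)
    *-distribˡ-∑ r f []       = sym (zeroʳ r)
    *-distribˡ-∑ r f (a ∷ as) = trans (+-congˡ (*-distribˡ-∑ r f as)) (sym (distribˡ r (f a) _))

    ∑-zero : (as : List A) → ∑ (L.map (λ _ → 0#) as) ≈ 0#
    ∑-zero []       = refl
    ∑-zero (_ ∷ as) = trans (+-identityˡ _) (∑-zero as)

    ∑-+ : (f g : A → Carrier) (as : List A) → ∑ (L.map (λ a → f a + g a) as) ≈ ∑ (L.map f as) + ∑ (L.map g as)
    ∑-+ f g []       = sym (+-identityˡ 0#)
    ∑-+ f g (a ∷ as) = trans (+-congˡ (∑-+ f g as)) (interchange (f a) (g a) _ _)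

  ∑-swap : ∀ {y} {A : Set x} {B : Set y} (f : A → B → Carrier) (as : List A) (bs : List B) →
           ∑ (L.map (λ a → ∑ (L.map (f a) bs)) as) ≈ ∑ (L.map (λ b → ∑ (L.map (λ a → f a b) as)) bs)
  ∑-swap f []       bs = sym (∑-zero bs)
  ∑-swap f (a ∷ as) bs = trans (+-congˡ (∑-swap f as bs)) (sym (∑-+ (f a) _ bs))

  module Telescoping {n : ℕ} (t H A Q : Fin n → Carrier) (H≈A+Qt : ∀ i → H i ≈ A i + Q i * t i) where

    factor : Fin n → Fin n → Carrier
    factor j i = byOrder i j (A i) (Q i) (H i)

    coefficient : List (Fin n) → Fin n → Carrier
    coefficient vs j = ∏ (L.map (factor j) vs) * t j

    telescope : {vs : List (Fin n)} → AllPairs Fin._<_ vs →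
                ∏ (L.map H vs) ≈ ∏ (L.map A vs) + ∑ (L.map (coefficient vs) vs)
    telescope {[]}     []                = sym (+-identityʳ 1#)
    telescope {i ∷ vs} (i<vs ∷ sortedVs) = begin
      H i * ∏ (L.map H vs)                    ≈⟨ *-cong (H≈A+Qt i) IH ⟩
      (A i + Q i * t i) * (∏A + S)            ≈⟨ expand (A i) (Q i) (t i) ∏A S ⟩
      A i * ∏A + (Q i * (∏A + S) * t i + A i * S)
        ≈⟨ +-congˡ (+-cong (*-congʳ (*-cong (reflexive (≡.sym (byOrder-≡ i))) (sym factorsAfter)))
                           (sym factorsBefore)) ⟩
      A i * ∏A + (coefficient (i ∷ vs) i + ∑ (L.map (coefficient (i ∷ vs)) vs)) ∎
      where
      ∏A = ∏ (L.map A vs)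
      S  = ∑ (L.map (coefficient vs) vs)
      IH = telescope sortedVs

      expand : ∀ a q τ p s → (a + q * τ) * (p + s) ≈ a * p + (q * (p + s) * τ + a * s)
      expand = solve 5 (λ a q τ p s → (a :+ q :* τ) :* (p :+ s) := a :* p :+ (q :* (p :+ s) :* τ :+ a :* s)) refl

      factorsAfter : ∏ (L.map (factor i) vs) ≈ ∏A + S
      factorsAfter = trans (∏-cong (All.map (λ i<j → reflexive (byOrder-> i<j)) i<vs)) IH

      factorsBefore : ∑ (L.map (coefficient (i ∷ vs)) vs) ≈ A i * S
      factorsBefore = trans
        (∑-cong (All.map (λ i<j → trans (*-congʳ (*-congʳ (reflexive (byOrder-< i<j)))) (*-assoc _ _ _)) i<vs))
        (*-distribˡ-∑ (A i) (coefficient vs) vs)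

  horner : List Carrier → Carrier → Carrier
  horner cs z = L.foldr (λ c acc → c + z * acc) 0# cs

  horner-cong : ∀ {cs ds} z → Pointwise _≈_ cs ds → horner cs z ≈ horner ds z
  horner-cong z []              = refl
  horner-cong z (c≈d ∷ cs≈ds) = +-cong c≈d (*-congˡ (horner-cong z cs≈ds))

  tailSums : List Carrier → List Carrier
  tailSums []       = []
  tailSums (c ∷ cs) = ∑ cs ∷ tailSums cs

  length-tailSums : ∀ cs → L.length (tailSums cs) ≡ L.length cs
  length-tailSums []       = ≡.refl
  length-tailSums (c ∷ cs) = ≡.cong suc (length-tailSums cs)

  -- Division with remainder by t = z² − z: the remainder c₀ + (c₁ + ⋯ + c_D) z is the
  -- multilinearization of c₀ + c₁ z + ⋯ + c_D z^D.
  horner-divMod : ∀ {z t} → z * z ≈ z + t → ∀ c cs →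
                  horner (c ∷ cs) z ≈ (c + ∑ cs * z) + horner (tailSums cs) z * t
  horner-divMod {z} {t} z²≈z+t c [] =
    solve 3 (λ c z t → c :+ z :* con 0 := (c :+ con 0 :* z) :+ con 0 :* t) refl c z t
  horner-divMod {z} {t} z²≈z+t c (c′ ∷ cs) = begin
    c + z * horner (c′ ∷ cs) z               ≈⟨ +-congˡ (*-congˡ (horner-divMod z²≈z+t c′ cs)) ⟩
    c + z * ((c′ + β * z) + q * t)           ≈⟨ regroup c c′ β z q t ⟩
    (c + c′ * z) + (β * (z * z) + z * q * t) ≈⟨ +-congˡ (+-congʳ (*-congˡ z²≈z+t)) ⟩
    (c + c′ * z) + (β * (z + t) + z * q * t) ≈⟨ collect c c′ β z q t ⟩
    (c + (c′ + β) * z) + (β + z * q) * t     ∎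
    where
    β = ∑ cs
    q = horner (tailSums cs) z

    regroup : ∀ c c′ β z q t → c + z * ((c′ + β * z) + q * t) ≈ (c + c′ * z) + (β * (z * z) + z * q * t)
    regroup = solve 6 (λ c c′ β z q t →
      c :+ z :* ((c′ :+ β :* z) :+ q :* t) := (c :+ c′ :* z) :+ (β :* (z :* z) :+ z :* q :* t)) refl

    collect : ∀ c c′ β z q t → (c + c′ * z) + (β * (z + t) + z * q * t) ≈ (c + (c′ + β) * z) + (β + z * q) * t
    collect = solve 6 (λ c c′ β z q t →
      (c :+ c′ :* z) :+ (β :* (z :+ t) :+ z :* q :* t) := (c :+ (c′ :+ β) :* z) :+ (β :+ z :* q) :* t) refl

-- The commutative semiring of polynomials

module PolynomialSemiring {a ℓ} (F : Field a ℓ) (n : ℕ) where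
  open Field F
  open Poly F n
  open import Relation.Binary.Reasoning.Setoid setoid
  open import Algebra.Properties.CommutativeSemigroup +-commutativeSemigroup using (x∙yz≈y∙xz)
  module K = CommutativeSemiringLemmas commutativeSemiring

  -- The coefficient of z^e in c z^e′, decided as in Poly.coeff.
  δ : Exp → Exp → Carrier → Carrier
  δ e e′ c with VecP.≡-dec ℕ._≟_ e e′
  ... | yes _ = c
  ... | no  _ = 0#

  δᵗ : Exp → Carrier × Exp → Carrier
  δᵗ e (c , e′) = δ e e′ c

  δ-cong : ∀ e e′ {c d} → c ≈ d → δ e e′ c ≈ δ e e′ d
  δ-cong e e′ c≈d with VecP.≡-dec ℕ._≟_ e e′
  ... | yes _ = c≈d
  ... | no  _ = refl

  δ-*ˡ : ∀ e e′ c d → δ e e′ (c * d) ≈ c * δ e e′ d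
  δ-*ˡ e e′ c d with VecP.≡-dec ℕ._≟_ e e′
  ... | yes _ = refl
  ... | no  _ = sym (zeroʳ c)

  δ-+ : ∀ e e′ c d → δ e e′ (c + d) ≈ δ e e′ c + δ e e′ d
  δ-+ e e′ c d with VecP.≡-dec ℕ._≟_ e e′
  ... | yes _ = refl
  ... | no  _ = sym (+-identityˡ 0#)

  δ-0# : ∀ e e′ → δ e e′ 0# ≈ 0#
  δ-0# e e′ with VecP.≡-dec ℕ._≟_ e e′
  ... | yes _ = refl
  ... | no  _ = refl

  δ-≢ : ∀ {e e′} c → e ≢ e′ → δ e e′ c ≈ 0#
  δ-≢ {e} {e′} c e≢e′ with VecP.≡-dec ℕ._≟_ e e′
  ... | yes e≡e′ = contradiction e≡e′ e≢e′
  ... | no  _    = refl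

  δ-resp : ∀ {e e′ f f′} c → (e ≡ e′ → f ≡ f′) → (f ≡ f′ → e ≡ e′) → δ e e′ c ≈ δ f f′ c
  δ-resp {e} {e′} {f} {f′} c to from with VecP.≡-dec ℕ._≟_ e e′ | VecP.≡-dec ℕ._≟_ f f′
  ... | yes _   | yes _   = refl
  ... | no  _   | no  _   = refl
  ... | yes e≡e′ | no f≢f′ = contradiction (to e≡e′) f≢f′
  ... | no e≢e′ | yes f≡f′ = contradiction (from f≡f′) e≢e′

  coeff-∷ : ∀ t p e → coeff (t ∷ p) e ≈ δᵗ e t + coeff p e
  coeff-∷ (c , e′) p e with VecP.≡-dec ℕ._≟_ e e′
  ... | yes _ = refl
  ... | no  _ = sym (+-identityˡ _)

  coeff-++ : ∀ p q e → coeff (p ++ q) e ≈ coeff p e + coeff q e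
  coeff-++ []      q e = sym (+-identityˡ _)
  coeff-++ (t ∷ p) q e = begin
    coeff (t ∷ p ++ q) e                   ≈⟨ coeff-∷ t (p ++ q) e ⟩
    δᵗ e t + coeff (p ++ q) e              ≈⟨ +-congˡ (coeff-++ p q e) ⟩
    δᵗ e t + (coeff p e + coeff q e)       ≈⟨ sym (+-assoc _ _ _) ⟩
    (δᵗ e t + coeff p e) + coeff q e       ≈⟨ +-congʳ (sym (coeff-∷ t p e)) ⟩
    coeff (t ∷ p) e + coeff q e            ∎

  coeff-∑ : ∀ p e → coeff p e ≈ K.∑ (L.map (δᵗ e) p)
  coeff-∑ []      e = refl
  coeff-∑ (t ∷ p) e = trans (coeff-∷ t p e) (+-congˡ (coeff-∑ p e))

  -- _≈ₚ_ is a Π-type from which Agda cannot infer the two polynomials; wrapping it in a record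
  -- makes it usable as the equality of an algebraic structure.
  infix 4 _≋_
  record _≋_ (p q : Polynomial) : Set ℓ where
    constructor mk≋
    field coeff-≈ : p ≈ₚ q
  open _≋_ public

  infix 4 _≈ᵗ_ _∼_
  _≈ᵗ_ : Carrier × Exp → Carrier × Exp → Set ℓ
  _≈ᵗ_ = ×-Pointwise _≈_ _≡_

  _∼_ : Polynomial → Polynomial → Set (a ⊔ ℓ)
  _∼_ = Pointwise _≈ᵗ_

  ∼⇒≋ : ∀ {p q} → p ∼ q → p ≋ q
  ∼⇒≋ []                                                 = mk≋ λ e → refl
  ∼⇒≋ {(c , e′) ∷ p} {(d , .e′) ∷ q} ((c≈d , ≡.refl) ∷ p∼q) = mk≋ λ e → begin
    coeff ((c , e′) ∷ p) e     ≈⟨ coeff-∷ (c , e′) p e ⟩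
    δ e e′ c + coeff p e       ≈⟨ +-cong (δ-cong e e′ c≈d) (coeff-≈ (∼⇒≋ p∼q) e) ⟩
    δ e e′ d + coeff q e       ≈⟨ sym (coeff-∷ (d , e′) q e) ⟩
    coeff ((d , e′) ∷ q) e     ∎

  ≋-isEquivalence : IsEquivalence _≋_
  ≋-isEquivalence = record
    { refl  = mk≋ λ e → refl
    ; sym   = λ p≋q → mk≋ λ e → sym (coeff-≈ p≋q e)
    ; trans = λ p≋q q≋r → mk≋ λ e → trans (coeff-≈ p≋q e) (coeff-≈ q≋r e)
    }

  module ≋ = IsEquivalence ≋-isEquivalence

  ≡⇒≋ : ∀ {p q} → p ≡ q → p ≋ q
  ≡⇒≋ ≡.refl = ≋.refl

  ∷-cong : ∀ s {p q} → p ≋ q → s ∷ p ≋ s ∷ q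
  ∷-cong s {p} {q} p≋q = mk≋ λ e →
    trans (coeff-∷ s p e) (trans (+-congˡ (coeff-≈ p≋q e)) (sym (coeff-∷ s q e)))

  ∷-swap : ∀ s t p → s ∷ t ∷ p ≋ t ∷ s ∷ p
  ∷-swap s t p = mk≋ λ e →
    trans (coeff-∑ (s ∷ t ∷ p) e) (trans (x∙yz≈y∙xz _ _ _) (sym (coeff-∑ (t ∷ s ∷ p) e)))

  ∷-merge : ∀ c d e′ p → (c , e′) ∷ (d , e′) ∷ p ≋ (c + d , e′) ∷ p
  ∷-merge c d e′ p = mk≋ λ e → begin
    coeff ((c , e′) ∷ (d , e′) ∷ p) e           ≈⟨ coeff-∑ ((c , e′) ∷ (d , e′) ∷ p) e ⟩
    δ e e′ c + (δ e e′ d + K.∑ (L.map (δᵗ e) p)) ≈⟨ sym (+-assoc _ _ _) ⟩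
    δ e e′ c + δ e e′ d + K.∑ (L.map (δᵗ e) p)   ≈⟨ +-congʳ (sym (δ-+ e e′ c d)) ⟩
    δ e e′ (c + d) + K.∑ (L.map (δᵗ e) p)        ≈⟨ sym (coeff-∑ ((c + d , e′) ∷ p) e) ⟩
    coeff ((c + d , e′) ∷ p) e                  ∎

  ∷-zero : ∀ e′ p → (0# , e′) ∷ p ≋ p
  ∷-zero e′ p = mk≋ λ e → trans (coeff-∷ (0# , e′) p e) (trans (+-congʳ (δ-0# e e′)) (+-identityˡ _))

  -- The product of terms used by Poly._*ₚ_, so that (s ∷ p) *ₚ q reduces to L.map (s ·ᵗ_) q ++ p *ₚ q.
  infixl 7 _·ᵗ_
  _·ᵗ_ : Carrier × Exp → Carrier × Exp → Carrier × Exp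
  (c , e) ·ᵗ (d , f) = (c * d , e +ᵥ f)

  shift : Exp → Carrier × Exp → Carrier × Exp
  shift e′ (d , f) = (d , e′ +ᵥ f)

  coeff-map-·ᵗ : ∀ c e′ q e → coeff (L.map ((c , e′) ·ᵗ_) q) e ≈ c * coeff (L.map (shift e′) q) e
  coeff-map-·ᵗ c e′ []            e = sym (zeroʳ c)
  coeff-map-·ᵗ c e′ ((d , f) ∷ q) e = begin
    coeff ((c * d , e′ +ᵥ f) ∷ L.map ((c , e′) ·ᵗ_) q) e     ≈⟨ coeff-∷ (c * d , e′ +ᵥ f) (L.map ((c , e′) ·ᵗ_) q) e ⟩
    δ e (e′ +ᵥ f) (c * d) + coeff (L.map ((c , e′) ·ᵗ_) q) e ≈⟨ +-cong (δ-*ˡ e (e′ +ᵥ f) c d) (coeff-map-·ᵗ c e′ q e) ⟩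
    c * δ e (e′ +ᵥ f) d + c * coeff (L.map (shift e′) q) e   ≈⟨ sym (distribˡ c (δ e (e′ +ᵥ f) d) _) ⟩
    c * (δ e (e′ +ᵥ f) d + coeff (L.map (shift e′) q) e)     ≈⟨ *-congˡ (sym (coeff-∷ (d , e′ +ᵥ f) (L.map (shift e′) q) e)) ⟩
    c * coeff ((d , e′ +ᵥ f) ∷ L.map (shift e′) q) e         ∎

  -- z^e occurs in z^e′ · q only if e = e′ + (e ∸ e′), and then with the coefficient of z^(e ∸ e′) in q.
  coeff-map-shift : ∀ e′ q e → e ≡ e′ +ᵥ (e ∸ᵥ e′) → coeff (L.map (shift e′) q) e ≈ coeff q (e ∸ᵥ e′)
  coeff-map-shift e′ []            e e≡ = refl
  coeff-map-shift e′ ((d , f) ∷ q) e e≡ = begin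
    coeff ((d , e′ +ᵥ f) ∷ L.map (shift e′) q) e     ≈⟨ coeff-∷ (d , e′ +ᵥ f) (L.map (shift e′) q) e ⟩
    δ e (e′ +ᵥ f) d + coeff (L.map (shift e′) q) e   ≈⟨ +-cong (δ-resp d to from) (coeff-map-shift e′ q e e≡) ⟩
    δ (e ∸ᵥ e′) f d + coeff q (e ∸ᵥ e′)              ≈⟨ sym (coeff-∷ (d , f) q (e ∸ᵥ e′)) ⟩
    coeff ((d , f) ∷ q) (e ∸ᵥ e′)                    ∎
    where
    to : e ≡ e′ +ᵥ f → e ∸ᵥ e′ ≡ f
    to e≡e′+f = ≡.trans (≡.cong (_∸ᵥ e′) e≡e′+f) (+ᵥ-∸ᵥ-cancelˡ e′ f)
    from : e ∸ᵥ e′ ≡ f → e ≡ e′ +ᵥ f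
    from e∸e′≡f = ≡.trans e≡ (≡.cong (e′ +ᵥ_) e∸e′≡f)

  coeff-map-shift-∉ : ∀ e′ q e → e ≢ e′ +ᵥ (e ∸ᵥ e′) → coeff (L.map (shift e′) q) e ≈ 0#
  coeff-map-shift-∉ e′ []            e e≢ = refl
  coeff-map-shift-∉ e′ ((d , f) ∷ q) e e≢ = begin
    coeff ((d , e′ +ᵥ f) ∷ L.map (shift e′) q) e     ≈⟨ coeff-∷ (d , e′ +ᵥ f) (L.map (shift e′) q) e ⟩
    δ e (e′ +ᵥ f) d + coeff (L.map (shift e′) q) e   ≈⟨ +-cong (δ-≢ d e≢e′+f) (coeff-map-shift-∉ e′ q e e≢) ⟩
    0# + 0#                                          ≈⟨ +-identityˡ 0# ⟩
    0#                                               ∎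
    where
    e≢e′+f : e ≢ e′ +ᵥ f
    e≢e′+f e≡e′+f = e≢ (≡.trans e≡e′+f (≡.cong (e′ +ᵥ_)
      (≡.sym (≡.trans (≡.cong (_∸ᵥ e′) e≡e′+f) (+ᵥ-∸ᵥ-cancelˡ e′ f)))))

  map-shift-cong : ∀ e′ {q q′} → q ≋ q′ → L.map (shift e′) q ≋ L.map (shift e′) q′
  map-shift-cong e′ {q} {q′} q≋q′ = mk≋ λ e → case e
    where
    case : ∀ e → coeff (L.map (shift e′) q) e ≈ coeff (L.map (shift e′) q′) e
    case e with VecP.≡-dec ℕ._≟_ e (e′ +ᵥ (e ∸ᵥ e′))
    ... | yes e≡ = trans (coeff-map-shift e′ q e e≡)
                         (trans (coeff-≈ q≋q′ (e ∸ᵥ e′)) (sym (coeff-map-shift e′ q′ e e≡)))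
    ... | no  e≢ = trans (coeff-map-shift-∉ e′ q e e≢) (sym (coeff-map-shift-∉ e′ q′ e e≢))

  +ₚ-cong : ∀ {p p′ q q′} → p ≋ p′ → q ≋ q′ → p +ₚ q ≋ p′ +ₚ q′
  +ₚ-cong {p} {p′} {q} {q′} p≋p′ q≋q′ = mk≋ λ e →
    trans (coeff-++ p q e) (trans (+-cong (coeff-≈ p≋p′ e) (coeff-≈ q≋q′ e)) (sym (coeff-++ p′ q′ e)))

  *ₚ-congˡ : ∀ p {q q′} → q ≋ q′ → p *ₚ q ≋ p *ₚ q′
  *ₚ-congˡ []             q≋q′ = mk≋ λ e → refl
  *ₚ-congˡ ((c , e′) ∷ p) {q} {q′} q≋q′ = +ₚ-cong (mk≋ scaled) (*ₚ-congˡ p q≋q′)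
    where
    scaled : L.map ((c , e′) ·ᵗ_) q ≈ₚ L.map ((c , e′) ·ᵗ_) q′
    scaled e = trans (coeff-map-·ᵗ c e′ q e)
                     (trans (*-congˡ (coeff-≈ (map-shift-cong e′ q≋q′) e)) (sym (coeff-map-·ᵗ c e′ q′ e)))

  coeff-*ₚ : ∀ p q e → coeff (p *ₚ q) e ≈ K.∑ (L.map (λ s → K.∑ (L.map (λ t → δᵗ e (s ·ᵗ t)) q)) p)
  coeff-*ₚ []      q e = refl
  coeff-*ₚ (s ∷ p) q e = begin
    coeff (L.map (s ·ᵗ_) q ++ p *ₚ q) e              ≈⟨ coeff-++ (L.map (s ·ᵗ_) q) (p *ₚ q) e ⟩
    coeff (L.map (s ·ᵗ_) q) e + coeff (p *ₚ q) e     ≈⟨ +-cong (coeff-∑ (L.map (s ·ᵗ_) q) e) (coeff-*ₚ p q e) ⟩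
    K.∑ (L.map (δᵗ e) (L.map (s ·ᵗ_) q)) + rest      ≈⟨ +-congʳ (reflexive (≡.cong K.∑ (≡.sym (LP.map-∘ q)))) ⟩
    K.∑ (L.map (λ t → δᵗ e (s ·ᵗ t)) q) + rest       ∎
    where rest = K.∑ (L.map (λ s′ → K.∑ (L.map (λ t → δᵗ e (s′ ·ᵗ t)) q)) p)

  ·ᵗ-comm : ∀ e s t → δᵗ e (s ·ᵗ t) ≈ δᵗ e (t ·ᵗ s)
  ·ᵗ-comm e (c , f) (d , g) rewrite +ᵥ-comm f g = δ-cong e (g +ᵥ f) (*-comm c d)

  -- Both coefficients are the double sum of the coefficients of the term products.
  *ₚ-comm : ∀ p q → p *ₚ q ≋ q *ₚ p
  *ₚ-comm p q = mk≋ λ e → begin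
    coeff (p *ₚ q) e                                          ≈⟨ coeff-*ₚ p q e ⟩
    K.∑ (L.map (λ s → K.∑ (L.map (λ t → δᵗ e (s ·ᵗ t)) q)) p)  ≈⟨ K.∑-swap (λ s t → δᵗ e (s ·ᵗ t)) p q ⟩
    K.∑ (L.map (λ t → K.∑ (L.map (λ s → δᵗ e (s ·ᵗ t)) p)) q)
      ≈⟨ K.∑-cong (All.universal (λ t → K.∑-cong (All.universal (λ s → ·ᵗ-comm e s t) p)) q) ⟩
    K.∑ (L.map (λ t → K.∑ (L.map (λ s → δᵗ e (t ·ᵗ s)) p)) q)  ≈⟨ sym (coeff-*ₚ q p e) ⟩
    coeff (q *ₚ p) e                                          ∎

  *ₚ-distribʳ : ∀ p q r → (p ++ q) *ₚ r ≡ p *ₚ r ++ q *ₚ r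
  *ₚ-distribʳ []      q r = ≡.refl
  *ₚ-distribʳ (s ∷ p) q r = ≡.trans (≡.cong (L.map (s ·ᵗ_) r ++_) (*ₚ-distribʳ p q r))
                                    (≡.sym (LP.++-assoc (L.map (s ·ᵗ_) r) (p *ₚ r) (q *ₚ r)))

  map-·ᵗ-assoc : ∀ s t r → L.map ((s ·ᵗ t) ·ᵗ_) r ∼ L.map (s ·ᵗ_) (L.map (t ·ᵗ_) r)
  map-·ᵗ-assoc s t []            = []
  map-·ᵗ-assoc (c , e) (d , f) ((k , g) ∷ r) = (*-assoc c d k , +ᵥ-assoc e f g) ∷ map-·ᵗ-assoc (c , e) (d , f) r

  map-·ᵗ-*ₚ : ∀ s q r → L.map (s ·ᵗ_) q *ₚ r ∼ L.map (s ·ᵗ_) (q *ₚ r)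
  map-·ᵗ-*ₚ s []      r = []
  map-·ᵗ-*ₚ s (t ∷ q) r =
    ≡.subst (L.map (s ·ᵗ_) (t ∷ q) *ₚ r ∼_) (≡.sym (LP.map-++ (s ·ᵗ_) (L.map (t ·ᵗ_) r) (q *ₚ r)))
    (Pw.++⁺ (map-·ᵗ-assoc s t r) (map-·ᵗ-*ₚ s q r))

  *ₚ-assoc : ∀ p q r → p *ₚ q *ₚ r ∼ p *ₚ (q *ₚ r)
  *ₚ-assoc []      q r = []
  *ₚ-assoc (s ∷ p) q r = ≡.subst (_∼ (s ∷ p) *ₚ (q *ₚ r)) (≡.sym (*ₚ-distribʳ (L.map (s ·ᵗ_) q) (p *ₚ q) r))
    (Pw.++⁺ (map-·ᵗ-*ₚ s q r) (*ₚ-assoc p q r))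

  *ₚ-identityˡ : ∀ p → oneP *ₚ p ∼ p
  *ₚ-identityˡ []            = []
  *ₚ-identityˡ ((d , f) ∷ p) = (*-identityˡ d , +ᵥ-identityˡ f) ∷ *ₚ-identityˡ p

  *ₚ-cong : ∀ {p p′ q q′} → p ≋ p′ → q ≋ q′ → p *ₚ q ≋ p′ *ₚ q′
  *ₚ-cong {p} {p′} {q} {q′} p≋p′ q≋q′ =
    ≋.trans (*ₚ-congˡ p q≋q′) (≋.trans (*ₚ-comm p q′) (≋.trans (*ₚ-congˡ q′ p≋p′) (*ₚ-comm q′ p′)))

  +ₚ-comm : ∀ p q → p +ₚ q ≋ q +ₚ p
  +ₚ-comm p q = mk≋ λ e → trans (coeff-++ p q e) (trans (+-comm _ _) (sym (coeff-++ q p e)))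

  polynomialSemiring : CommutativeSemiring a ℓ
  polynomialSemiring = record
    { Carrier = Polynomial
    ; _≈_     = _≋_
    ; _+_     = _+ₚ_
    ; _*_     = _*ₚ_
    ; 0#      = zeroP
    ; 1#      = oneP
    ; isCommutativeSemiring = isCommutativeSemiringˡ record
      { +-isCommutativeMonoid = isCommutativeMonoidˡ record
        { isSemigroup = record
          { isMagma = record { isEquivalence = ≋-isEquivalence ; ∙-cong = +ₚ-cong }
          ; assoc   = λ p q r → ≡⇒≋ (LP.++-assoc p q r)
          }
        ; identityˡ = λ p → ≋.refl
        ; comm      = +ₚ-comm
        }
      ; *-isCommutativeMonoid = isCommutativeMonoidˡ record
        { isSemigroup = record
          { isMagma = record { isEquivalence = ≋-isEquivalence ; ∙-cong = *ₚ-cong }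
          ; assoc   = λ p q r → ∼⇒≋ (*ₚ-assoc p q r)
          }
        ; identityˡ = λ p → ∼⇒≋ (*ₚ-identityˡ p)
        ; comm      = *ₚ-comm
        }
      ; distribʳ = λ p q r → ≡⇒≋ (*ₚ-distribʳ q r p)
      ; zeroˡ    = λ p → ≋.refl
      }
    }
    where open import Algebra.Structures.Biased _≋_ using (isCommutativeSemiringˡ; isCommutativeMonoidˡ)

  module P = CommutativeSemiringLemmas polynomialSemiring
  module ≋-Reasoning = Relation.Binary.Reasoning.Setoid (CommutativeSemiring.setoid polynomialSemiring)

  const : Carrier → Polynomial
  const c = (c , 0ᵥ) ∷ []

  const-∑ : ∀ cs → const (K.∑ cs) ≋ P.∑ (L.map const cs)
  const-∑ []       = ∷-zero 0ᵥ []
  const-∑ (c ∷ cs) = ≋.trans (≋.sym (∷-merge c (K.∑ cs) 0ᵥ [])) (∷-cong (c , 0ᵥ) (const-∑ cs))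

  tailSums-const : ∀ cs → Pointwise _≋_ (P.tailSums (L.map const cs)) (L.map const (K.tailSums cs))
  tailSums-const []       = []
  tailSums-const (c ∷ cs) = ≋.sym (const-∑ cs) ∷ tailSums-const cs

-- Multilinearization

module Multilinearization {a ℓ} (F : Field a ℓ) (n : ℕ) where
  open Field F using (Carrier; _*_)
  open Poly F n
  open PolynomialSemiring F n using (_·ᵗ_)
  open ≡.≡-Reasoning

  -- Poly.ml rewrites term lists and need not respect _≈ₚ_, so it is handled by syntactic equalities.
  mlᵗ : Carrier × Exp → Carrier × Exp
  mlᵗ (c , e) = (c , mlExp e)

  ml-map-·ᵗ : ∀ s q → ml (L.map (s ·ᵗ_) q) ≡ ml (L.map (mlᵗ s ·ᵗ_) (ml q))
  ml-map-·ᵗ s             []            = ≡.refl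
  ml-map-·ᵗ s@(c , e) ((d , f) ∷ q) = ≡.cong₂ _∷_ (≡.cong (c * d ,_) (mlExp-+ᵥ e f)) (ml-map-·ᵗ s q)

  ml-*ₚ : ∀ p q → ml (p *ₚ q) ≡ ml (ml p *ₚ ml q)
  ml-*ₚ []      q = ≡.refl
  ml-*ₚ (s ∷ p) q = begin
    ml (L.map (s ·ᵗ_) q ++ p *ₚ q)                                ≡⟨ LP.map-++ mlᵗ (L.map (s ·ᵗ_) q) (p *ₚ q) ⟩
    ml (L.map (s ·ᵗ_) q) ++ ml (p *ₚ q)                           ≡⟨ ≡.cong₂ _++_ (ml-map-·ᵗ s q) (ml-*ₚ p q) ⟩
    ml (L.map (mlᵗ s ·ᵗ_) (ml q)) ++ ml (ml p *ₚ ml q)            ≡⟨ LP.map-++ mlᵗ (L.map (mlᵗ s ·ᵗ_) (ml q)) _ ⟨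
    ml (L.map (mlᵗ s ·ᵗ_) (ml q) ++ ml p *ₚ ml q)                 ∎

  ml-idem : ∀ p → ml (ml p) ≡ ml p
  ml-idem []            = ≡.refl
  ml-idem ((c , e) ∷ p) = ≡.cong₂ _∷_ (≡.cong (c ,_) (mlExp-idem e)) (ml-idem p)

  ml-∏ : ∀ {A : Set x} (f : A → Polynomial) as → ml (prodP (L.map f as)) ≡ ml (prodP (L.map (ml ∘ f) as))
  ml-∏ f []       = ≡.refl
  ml-∏ f (a ∷ as) = begin
    ml (f a *ₚ P)                ≡⟨ ml-*ₚ (f a) P ⟩
    ml (ml (f a) *ₚ ml P)        ≡⟨ ≡.cong (λ p → ml (ml (f a) *ₚ p)) (ml-∏ f as) ⟩
    ml (ml (f a) *ₚ ml P′)       ≡⟨ ≡.cong (λ p → ml (p *ₚ ml P′)) (ml-idem (f a)) ⟨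
    ml (ml (ml (f a)) *ₚ ml P′)  ≡⟨ ml-*ₚ (ml (f a)) P′ ⟨
    ml (ml (f a) *ₚ P′)          ∎
    where
    P  = prodP (L.map f as)
    P′ = prodP (L.map (ml ∘ f) as)

  MultilinearInₚ : List (Fin n) → Polynomial → Set a
  MultilinearInₚ vs = All (MultilinearIn vs ∘ proj₂)

  ml-multilinearIn : ∀ {vs p} → MultilinearInₚ vs p → ml p ≡ p
  ml-multilinearIn {p = []}          []        = ≡.refl
  ml-multilinearIn {p = (c , e) ∷ p} (me ∷ mp) =
    ≡.cong₂ _∷_ (≡.cong (c ,_) (mlExp-id (proj₁ ∘ me))) (ml-multilinearIn mp)

  *ₚ-multilinearIn : ∀ {i vs p q} → i ∉ vs →
    MultilinearInₚ (i ∷ []) p → MultilinearInₚ vs q → MultilinearInₚ (i ∷ vs) (p *ₚ q)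
  *ₚ-multilinearIn i∉vs []        mq = []
  *ₚ-multilinearIn {p = s ∷ _} i∉vs (me ∷ mp) mq =
    AllP.++⁺ (AllP.map⁺ (All.map (λ {t} → +ᵥ-multilinearIn (proj₂ s) (proj₂ t) i∉vs me) mq))
             (*ₚ-multilinearIn i∉vs mp mq)

  ∏-multilinearIn : ∀ (f : Fin n → Polynomial) {vs} → Unique vs →
    (∀ i → MultilinearInₚ (i ∷ []) (f i)) → MultilinearInₚ vs (prodP (L.map f vs))
  ∏-multilinearIn f []           mf = 0ᵥ-multilinearIn ∷ []
  ∏-multilinearIn f (i∉vs ∷ uvs) mf = *ₚ-multilinearIn (AllP.All¬⇒¬Any i∉vs) (mf _) (∏-multilinearIn f uvs mf)

  ml-∏-distinct : ∀ (f : Fin n → Polynomial) {vs} → Unique vs → (∀ i → MultilinearInₚ (i ∷ []) (ml (f i))) →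
                  ml (prodP (L.map f vs)) ≡ prodP (L.map (ml ∘ f) vs)
  ml-∏-distinct f {vs} uvs mf = ≡.trans (ml-∏ f vs) (ml-multilinearIn (∏-multilinearIn (ml ∘ f) uvs mf))

-- Univariate polynomials hᵢ(zᵢ) and the sum gates computing them

module Univariate {a ℓ} (F : Field a ℓ) {n : ℕ} (i : Fin n) where
  open Field F
  open Poly F n
  open PolynomialSemiring F n
  open Multilinearization F n using (MultilinearInₚ)

  z t : Polynomial
  z = varP i
  t = booleanAxiom i

  z*z≋z+t : z *ₚ z ≋ z +ₚ t
  z*z≋z+t = begin
    z *ₚ z                                      ≈⟨ ∼⇒≋ ((*-identityˡ 1# , unitVec-+ i 1 1) ∷ []) ⟩
    (1# , u₂) ∷ []                              ≈⟨ ∷-cong (1# , u₂) (∷-zero u₁ []) ⟨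
    (1# , u₂) ∷ (0# , u₁) ∷ []                  ≈⟨ ∷-cong (1# , u₂) (∼⇒≋ ((-‿inverseʳ 1# , ≡.refl) ∷ [])) ⟨
    (1# , u₂) ∷ (1# + - 1# , u₁) ∷ []           ≈⟨ ∷-cong (1# , u₂) (∷-merge 1# (- 1#) u₁ []) ⟨
    (1# , u₂) ∷ (1# , u₁) ∷ (- 1# , u₁) ∷ []    ≈⟨ ∷-swap (1# , u₁) (1# , u₂) ((- 1# , u₁) ∷ []) ⟨
    z +ₚ t                                      ∎
    where
    open ≋-Reasoning
    u₁ = unitVec i 1
    u₂ = unitVec i 2

  powersFrom : ℕ → List Carrier → Polynomial
  powersFrom s []       = []
  powersFrom s (c ∷ cs) = (c , unitVec i s) ∷ powersFrom (suc s) cs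

  tabulate-powersFrom : ∀ {m} (v : Vec Carrier m) s →
    L.tabulate (λ k → (V.lookup v k , unitVec i (s ℕ.+ Fin.toℕ k))) ≡ powersFrom s (V.toList v)
  tabulate-powersFrom []      s = ≡.refl
  tabulate-powersFrom (c ∷ v) s = ≡.cong₂ _∷_
    (≡.cong (λ e → (c , unitVec i e)) (ℕP.+-identityʳ s))
    (≡.trans (LP.tabulate-cong (λ k → ≡.cong (λ e → (V.lookup v k , unitVec i e)) (ℕP.+-suc s (Fin.toℕ k))))
             (tabulate-powersFrom v (suc s)))

  univariateAt-powersFrom : ∀ {D} (h : Vec Carrier (suc D)) → univariateAt h i ≡ powersFrom 0 (V.toList h)
  univariateAt-powersFrom h = ≡.trans (LP.map-tabulate (λ k → k) _) (tabulate-powersFrom h 0)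

  powersFrom-suc : ∀ s cs → powersFrom (suc s) cs ∼ z *ₚ powersFrom s cs
  powersFrom-suc s cs = ≡.subst (powersFrom (suc s) cs ∼_) (≡.sym (LP.++-identityʳ _)) (shifted s cs)
    where
    shifted : ∀ s cs → powersFrom (suc s) cs ∼ L.map ((1# , unitVec i 1) ·ᵗ_) (powersFrom s cs)
    shifted s []       = []
    shifted s (c ∷ cs) = (sym (*-identityˡ c) , ≡.sym (unitVec-+ i 1 s)) ∷ shifted (suc s) cs

  powersFrom-horner : ∀ cs → powersFrom 0 cs ≋ P.horner (L.map const cs) z
  powersFrom-horner []       = ≋.refl
  powersFrom-horner (c ∷ cs) = ≋.trans
    (∼⇒≋ ((refl , unitVec-zero i) ∷ powersFrom-suc 0 cs))
    (∷-cong (c , 0ᵥ) (*ₚ-congˡ z (powersFrom-horner cs)))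

  linear : Carrier → Carrier → Polynomial
  linear c β = const c +ₚ const β *ₚ z

  powersFrom-divMod : ∀ c cs →
    powersFrom 0 (c ∷ cs) ≋ linear c (K.∑ cs) +ₚ powersFrom 0 (K.tailSums cs) *ₚ t
  powersFrom-divMod c cs = begin
    powersFrom 0 (c ∷ cs)                      ≈⟨ powersFrom-horner (c ∷ cs) ⟩
    P.horner (L.map const (c ∷ cs)) z          ≈⟨ P.horner-divMod z*z≋z+t (const c) (L.map const cs) ⟩
    const c +ₚ P.∑ (L.map const cs) *ₚ z +ₚ P.horner (P.tailSums (L.map const cs)) z *ₚ t
      ≈⟨ +ₚ-cong (∷-cong (c , 0ᵥ) (*ₚ-cong (≋.sym (const-∑ cs)) ≋.refl))
                 (*ₚ-cong (≋.trans (P.horner-cong z (tailSums-const cs)) (≋.sym (powersFrom-horner (K.tailSums cs))))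
                          ≋.refl) ⟩
    linear c (K.∑ cs) +ₚ powersFrom 0 (K.tailSums cs) *ₚ t ∎
    where open ≋-Reasoning

  ml-powersFrom : ∀ c cs → ml (powersFrom 0 (c ∷ cs)) ≋ linear c (K.∑ cs)
  ml-powersFrom c cs = ≋.trans
    (∼⇒≋ ((refl , ≡.trans (mlExp-unitVec i 0) (unitVec-zero i)) ∷ linearTail cs 0))
    (∷-cong (c , 0ᵥ) (*ₚ-cong (≋.sym (const-∑ cs)) ≋.refl))
    where
    linearTail : ∀ cs s → ml (powersFrom (suc s) cs) ∼ P.∑ (L.map const cs) *ₚ z
    linearTail []       s = []
    linearTail (c ∷ cs) s =
      ( sym (*-identityʳ c)
      , ≡.trans (mlExp-unitVec i (suc s))
                (≡.trans (≡.cong (unitVec i ∘ suc) (ℕP.⊓-zeroʳ s)) (≡.sym (+ᵥ-identityˡ (unitVec i 1)))))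
      ∷ linearTail cs (suc s)

  ml-powersFrom-multilinearIn : ∀ s cs → MultilinearInₚ (i ∷ []) (ml (powersFrom s cs))
  ml-powersFrom-multilinearIn s []       = []
  ml-powersFrom-multilinearIn s (c ∷ cs) =
    ≡.subst (MultilinearIn (i ∷ [])) (≡.sym (mlExp-unitVec i s)) (unitVec-multilinearIn i (ℕP.m⊓n≤n s 1))
    ∷ ml-powersFrom-multilinearIn (suc s) cs

  powerGate : ℕ → ProdGate
  powerGate s = L.replicate s i

  powersGate : ℕ → List Carrier → SumGate
  powersGate s []       = []
  powersGate s (c ∷ cs) = (c , powerGate s) ∷ powersGate (suc s) cs

  linearGate : Carrier → Carrier → SumGate
  linearGate c β = (c , []) ∷ (β , i ∷ []) ∷ []

  evalProd-powerGate : ∀ s → evalProd (powerGate s) ≋ (1# , unitVec i s) ∷ []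
  evalProd-powerGate zero    = ∼⇒≋ ((refl , ≡.sym (unitVec-zero i)) ∷ [])
  evalProd-powerGate (suc s) =
    ≋.trans (*ₚ-congˡ z (evalProd-powerGate s)) (∼⇒≋ ((*-identityˡ 1# , unitVec-+ i 1 s) ∷ []))

  evalSum-powersGate : ∀ s cs → evalSum (powersGate s cs) ≋ powersFrom s cs
  evalSum-powersGate s []       = ≋.refl
  evalSum-powersGate s (c ∷ cs) = +ₚ-cong
    (≋.trans (*ₚ-congˡ (const c) (evalProd-powerGate s)) (∼⇒≋ ((*-identityʳ c , +ᵥ-identityˡ (unitVec i s)) ∷ [])))
    (evalSum-powersGate (suc s) cs)

  evalSum-linearGate : ∀ c β → evalSum (linearGate c β) ≋ linear c β
  evalSum-linearGate c β = ∼⇒≋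
    ( (*-identityʳ c , +ᵥ-identityˡ 0ᵥ)
    ∷ (*-congˡ (*-identityˡ 1#) , ≡.cong (0ᵥ +ᵥ_) (+ᵥ-identityʳ (unitVec i 1)))
    ∷ [])

-- Circuit size

module CircuitSize {a ℓ} (F : Field a ℓ) (n : ℕ) where
  open Poly F n
  open Univariate F using (powersGate; linearGate)
  open ℕP.≤-Reasoning

  size-≤ : ∀ {k} (C : ΠΣΠ) → All (λ g → sizeSum g ≤ k) C → size C ≤ suc (L.length C ℕ.* suc k)
  size-≤ []      []          = ℕP.≤-refl
  size-≤ (g ∷ C) (g≤k ∷ C≤k) = s≤s (ℕP.+-mono-≤ (s≤s g≤k) (ℕP.≤-pred (size-≤ C C≤k)))

  powersGate-size : ∀ (i : Fin n) d s cs → s ℕ.+ L.length cs ≤ suc d →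
                    sizeSum (powersGate i s cs) ≤ suc (L.length cs ℕ.* (2 ℕ.+ d))
  powersGate-size i d s []       _  = ℕP.≤-refl
  powersGate-size i d s (c ∷ cs) le = begin
    sizeSum (powersGate i s (c ∷ cs))                         ≡⟨ ℕP.+-suc (2 ℕ.+ L.length (L.replicate s i)) _ ⟨
    (2 ℕ.+ L.length (L.replicate s i)) ℕ.+ sizeSum (powersGate i (suc s) cs)
      ≤⟨ ℕP.+-mono-≤ (s≤s (s≤s (ℕP.≤-trans (ℕP.≤-reflexive (LP.length-replicate s)) s≤d)))
                     (powersGate-size i d (suc s) cs le′) ⟩
    (2 ℕ.+ d) ℕ.+ suc (L.length cs ℕ.* (2 ℕ.+ d))             ≡⟨ ℕP.+-suc (2 ℕ.+ d) _ ⟩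
    suc (L.length (c ∷ cs) ℕ.* (2 ℕ.+ d))                     ∎
    where
    le′ : suc s ℕ.+ L.length cs ≤ suc d
    le′ = ℕP.≤-trans (ℕP.≤-reflexive (≡.sym (ℕP.+-suc s (L.length cs)))) le
    s≤d : s ≤ d
    s≤d = ℕP.≤-pred (ℕP.≤-trans (s≤s (ℕP.m≤m+n s (L.length cs))) le′)

size-arithmetic : ∀ n D → 1 ≤ n → suc (n ℕ.* suc (6 ℕ.+ suc D ℕ.* (2 ℕ.+ D))) ≤ 10 ℕ.* n ℕ.* suc D ℕ.^ 2
size-arithmetic n D 1≤n = begin
  1 ℕ.+ n ℕ.* (7 ℕ.+ s ℕ.* (2 ℕ.+ D))       ≤⟨ ℕP.+-mono-≤ (ℕP.*-mono-≤ 1≤n 1≤s²) (ℕP.*-monoʳ-≤ n gate≤) ⟩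
  n ℕ.* (s ℕ.* s) ℕ.+ n ℕ.* (9 ℕ.* (s ℕ.* s)) ≡⟨ solve 2 (λ n s → n :* (s :* s) :+ n :* (con 9 :* (s :* s))
                                                         := con 10 :* n :* (s :^ 2)) ≡.refl n s ⟩
  10 ℕ.* n ℕ.* s ℕ.^ 2                       ∎
  where
  open ℕP.≤-Reasoning
  open +-*-Solver
  s = suc D
  1≤s² : 1 ≤ s ℕ.* s
  1≤s² = s≤s z≤n
  gate≤ : 7 ℕ.+ s ℕ.* (2 ℕ.+ D) ≤ 9 ℕ.* (s ℕ.* s)
  gate≤ = begin
    7 ℕ.+ s ℕ.* (2 ℕ.+ D)               ≤⟨ ℕP.+-mono-≤ (ℕP.*-monoʳ-≤ 7 1≤s²) (ℕP.*-monoʳ-≤ s (s≤s (ℕP.m≤n+m s D))) ⟩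
    7 ℕ.* (s ℕ.* s) ℕ.+ s ℕ.* (s ℕ.+ s) ≡⟨ solve 1 (λ s → con 7 :* (s :* s) :+ s :* (s :+ s) := con 9 :* (s :* s)) ≡.refl s ⟩
    9 ℕ.* (s ℕ.* s)                     ∎

module Construction {a ℓ} (F : Field a ℓ) (n D : ℕ) (h : Fin n → Vec (Field.Carrier F) (suc D)) where
  open Field F using (Carrier)
  open Poly F n
  open PolynomialSemiring F n
  open Multilinearization F n using (MultilinearInₚ; ml-∏-distinct)
  open Univariate F
  open CircuitSize F n

  lead : Fin n → Carrier
  lead i = V.head (h i)

  higher : Fin n → List Carrier
  higher i = V.toList (V.tail (h i))

  toList-h : ∀ i → V.toList (h i) ≡ lead i ∷ higher i
  toList-h i with h i
  ... | c ∷ cs = ≡.refl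

  Hgate Agate Qgate : Fin n → SumGate
  Hgate i = powersGate i 0 (V.toList (h i))
  Agate i = linearGate i (lead i) (K.∑ (higher i))
  Qgate i = powersGate i 0 (K.tailSums (higher i))

  -- Bⱼ = A₁ ⋯ Aⱼ₋₁ · Qⱼ · Hⱼ₊₁ ⋯ Hₙ.
  B : Fin n → ΠΣΠ
  B j = L.map (λ i → byOrder i j (Agate i) (Qgate i) (Hgate i)) (L.allFin n)

  H A Q : Fin n → Polynomial
  H i = evalSum (Hgate i)
  A i = evalSum (Agate i)
  Q i = evalSum (Qgate i)

  univariate≋H : ∀ i → univariateAt (h i) i ≋ H i
  univariate≋H i = ≋.trans (≡⇒≋ (univariateAt-powersFrom i (h i))) (≋.sym (evalSum-powersGate i 0 (V.toList (h i))))

  H≋A+Qt : ∀ i → H i ≋ A i +ₚ Q i *ₚ booleanAxiom i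
  H≋A+Qt i = begin
    H i                                 ≈⟨ evalSum-powersGate i 0 (V.toList (h i)) ⟩
    powersFrom i 0 (V.toList (h i))     ≡⟨ ≡.cong (powersFrom i 0) (toList-h i) ⟩
    powersFrom i 0 (lead i ∷ higher i)  ≈⟨ powersFrom-divMod i (lead i) (higher i) ⟩
    linear i (lead i) (K.∑ (higher i)) +ₚ powersFrom i 0 (K.tailSums (higher i)) *ₚ t i
      ≈⟨ +ₚ-cong (≋.sym (evalSum-linearGate i (lead i) (K.∑ (higher i))))
                 (*ₚ-cong (≋.sym (evalSum-powersGate i 0 (K.tailSums (higher i)))) ≋.refl) ⟩
    A i +ₚ Q i *ₚ booleanAxiom i        ∎
    where open ≋-Reasoning

  ml-univariate≋A : ∀ i → ml (univariateAt (h i) i) ≋ A i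
  ml-univariate≋A i = ≋.trans
    (≡⇒≋ (≡.cong ml (≡.trans (univariateAt-powersFrom i (h i)) (≡.cong (powersFrom i 0) (toList-h i)))))
    (≋.trans (ml-powersFrom i (lead i) (higher i)) (≋.sym (evalSum-linearGate i (lead i) (K.∑ (higher i)))))

  ml-univariate-multilinearIn : ∀ i → MultilinearInₚ (i ∷ []) (ml (univariateAt (h i) i))
  ml-univariate-multilinearIn i = ≡.subst (MultilinearInₚ (i ∷ []) ∘ ml) (≡.sym (univariateAt-powersFrom i (h i)))
    (ml-powersFrom-multilinearIn i 0 (V.toList (h i)))

  open P.Telescoping booleanAxiom H A Q H≋A+Qt

  eval-B : ∀ j → eval (B j) ≡ P.∏ (L.map (factor j) (L.allFin n))
  eval-B j = ≡.cong prodP (≡.trans (≡.sym (LP.map-∘ (L.allFin n)))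
                                   (LP.map-cong (λ i → byOrder-map evalSum i j) (L.allFin n)))

  B-identity : prodP (L.map (λ i → univariateAt (h i) i) (L.allFin n))
               ≈ₚ ml (prodP (L.map (λ i → univariateAt (h i) i) (L.allFin n)))
                  +ₚ sumP (L.map (λ j → eval (B j) *ₚ booleanAxiom j) (L.allFin n))
  B-identity = coeff-≈ (begin
    prodP (L.map f vs)                         ≈⟨ P.∏-cong (All.universal univariate≋H vs) ⟩
    P.∏ (L.map H vs)                           ≈⟨ telescope (AllPairsP.tabulate⁺-< (λ i<j → i<j)) ⟩
    P.∏ (L.map A vs) +ₚ P.∑ (L.map (coefficient vs) vs)
      ≈⟨ +ₚ-cong (≋.sym mlProduct) (≡⇒≋ coefficients) ⟩
    ml (prodP (L.map f vs)) +ₚ sumP (L.map (λ j → eval (B j) *ₚ booleanAxiom j) vs) ∎)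
    where
    open ≋-Reasoning
    vs = L.allFin n
    f : Fin n → Polynomial
    f i = univariateAt (h i) i
    coefficients : P.∑ (L.map (coefficient vs) vs) ≡ sumP (L.map (λ j → eval (B j) *ₚ booleanAxiom j) vs)
    coefficients = ≡.cong sumP (LP.map-cong (λ j → ≡.cong (_*ₚ booleanAxiom j) (≡.sym (eval-B j))) vs)
    mlProduct : ml (prodP (L.map f vs)) ≋ P.∏ (L.map A vs)
    mlProduct = ≋.trans (≡⇒≋ (ml-∏-distinct f (allFin⁺ n) ml-univariate-multilinearIn))
                        (P.∏-cong (All.universal ml-univariate≋A vs))

  gateBound : ℕ
  gateBound = 6 ℕ.+ suc D ℕ.* (2 ℕ.+ D)

  Hgate-size : ∀ i → sizeSum (Hgate i) ≤ gateBound
  Hgate-size i = begin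
    sizeSum (Hgate i)                                  ≤⟨ powersGate-size i D 0 (V.toList (h i)) (ℕP.≤-reflexive length≡) ⟩
    suc (L.length (V.toList (h i)) ℕ.* (2 ℕ.+ D))      ≡⟨ ≡.cong (λ k → suc (k ℕ.* (2 ℕ.+ D))) length≡ ⟩
    suc (suc D ℕ.* (2 ℕ.+ D))                          ≤⟨ ℕP.+-monoˡ-≤ (suc D ℕ.* (2 ℕ.+ D)) {1} {6} (s≤s z≤n) ⟩
    gateBound                                          ∎
    where
    open ℕP.≤-Reasoning
    length≡ = VecP.length-toList (h i)

  Qgate-size : ∀ i → sizeSum (Qgate i) ≤ gateBound
  Qgate-size i = begin
    sizeSum (Qgate i)                                  ≤⟨ powersGate-size i D 0 qs (ℕP.≤-trans (ℕP.≤-reflexive length≡) (ℕP.n≤1+n D)) ⟩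
    suc (L.length qs ℕ.* (2 ℕ.+ D))                    ≡⟨ ≡.cong (λ k → suc (k ℕ.* (2 ℕ.+ D))) length≡ ⟩
    suc (D ℕ.* (2 ℕ.+ D))                              ≤⟨ ℕP.+-mono-≤ {1} {6} (s≤s z≤n) (ℕP.*-monoˡ-≤ (2 ℕ.+ D) (ℕP.n≤1+n D)) ⟩
    gateBound                                          ∎
    where
    open ℕP.≤-Reasoning
    qs = K.tailSums (higher i)
    length≡ : L.length qs ≡ D
    length≡ = ≡.trans (K.length-tailSums (higher i)) (VecP.length-toList (V.tail (h i)))

  Agate-size : ∀ i → sizeSum (Agate i) ≤ gateBound
  Agate-size i = ℕP.m≤m+n 6 _

  B-size : ∀ j → size (B j) ≤ 10 ℕ.* n ℕ.* suc D ℕ.^ 2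
  B-size j = begin
    size (B j)                               ≤⟨ size-≤ (B j) (AllP.map⁺ (All.universal gate-size (L.allFin n))) ⟩
    suc (L.length (B j) ℕ.* suc gateBound)   ≡⟨ ≡.cong (λ k → suc (k ℕ.* suc gateBound)) length≡ ⟩
    suc (n ℕ.* suc gateBound)                ≤⟨ size-arithmetic n D (ℕP.≤-trans (s≤s z≤n) (FinP.toℕ<n j)) ⟩
    10 ℕ.* n ℕ.* suc D ℕ.^ 2                 ∎
    where
    open ℕP.≤-Reasoning
    gate-size : ∀ i → sizeSum (byOrder i j (Agate i) (Qgate i) (Hgate i)) ≤ gateBound
    gate-size i = byOrder-preserves (λ g → sizeSum g ≤ gateBound) (Agate-size i) (Qgate-size i) (Hgate-size i) i j
    length≡ : L.length (B j) ≡ n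
    length≡ = ≡.trans (LP.length-map _ (L.allFin n)) (LP.length-tabulate (λ k → k))

open import Data.Nat using (_*_; _^_)
open import Data.List using (allFin; map)

mainTheorem12 : ∀ {a ℓ : Level} → Σ ℕ λ c → (F : Field a ℓ) (n D : ℕ)
    → (h : Fin n → Vec (Field.Carrier F) (suc D))
    → Σ (Fin n → Poly.ΠΣΠ F n) λ B
      → ((j : Fin n) → Poly.size F n (B j) ≤ c * n * suc D ^ 2)
      × Poly._≈ₚ_ F n
          (Poly.prodP F n (map (λ i → Poly.univariateAt F n (h i) i) (allFin n)))
          (Poly._+ₚ_ F n
            (Poly.ml F n (Poly.prodP F n (map (λ i → Poly.univariateAt F n (h i) i) (allFin n))))
            (Poly.sumP F n (map (λ j → Poly._*ₚ_ F n (Poly.eval F n (B j)) (Poly.booleanAxiom F n j)) (allFin n))))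
mainTheorem12 = 10 , λ F n D h → let open Construction F n D h in B , B-size , B-identity
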